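{- If $\mathsf{PA}\vdash\exists x\,\mathsf P$ with $\mathsf P$ atomic, then $\mathsf{HA}+\mathsf{EM}_1^-\vdash\exists x\,\mathsf P$.
   Context: $\mathsf{HA}$ is Heyting (intuitionistic) Arithmetic in natural deduction, with decidable atomic formulas; $\mathsf{PA}$ is $\mathsf{HA}$ plus the full excluded-middle rule (from $\Gamma,A\vdash C$ and $\Gamma,\neg A\vdash C$ infer $\Gamma\vdash C$, for arbitrary $A$, $C$). $\mathsf{EM}_1^-$ is the rule: for atomic $\mathsf Q$ and atomic $C$, from $\Gamma,\forall\alpha\mathsf Q\vdash\exists xC$ and $\Gamma,\exists\alpha\mathsf Q^\perp\vdash\exists xC$ (discharging these assumptions) infer $\Gamma\vdash\exists xC$, where $\mathsf Q^\perp$ is the atomic complement of $\mathsf Q$. -}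

module Defs where

open import Data.Nat using (ℕ; zero; suc; _<_)
open import Data.Fin using (Fin) renaming (zero to f0; suc to fs)
open import Data.Vec using (Vec; []; _∷_; lookup)
open import Data.List using (List; []; _∷_; map)
open import Data.List.Membership.Propositional using (_∈_)
open import Data.Unit using (⊤)
open import Data.Product using (_×_)

-- Primitive recursive function codes (the function symbols of HA)

data PR : ℕ → Set where
  Z    : ∀ {n} → PR n
  Succ : PR 1
  Proj : ∀ {n} → Fin n → PR n
  Comp : ∀ {m n} → PR m → Vec (PR n) m → PR n
  Rec  : ∀ {n} → PR n → PR (suc (suc n)) → PR (suc n)
  -- Rec g h (0 , xs)     = g xs
  -- Rec g h (S y , xs)   = h (Rec g h (y , xs) , y , xs)

-- Terms (de Bruijn variables)

data Term : Set where
  var : ℕ → Term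
  `0  : Term
  S   : Term → Term
  app : ∀ {n} → PR n → Vec Term n → Term

Subst : Set
Subst = ℕ → Term

mutual
  sub : Subst → Term → Term
  sub σ (var k)    = σ k
  sub σ `0         = `0
  sub σ (S t)      = S (sub σ t)
  sub σ (app f ts) = app f (subs σ ts)

  subs : ∀ {n} → Subst → Vec Term n → Vec Term n
  subs σ []       = []
  subs σ (t ∷ ts) = sub σ t ∷ subs σ ts

appAll : ∀ {m n} → Vec (PR n) m → Vec Term n → Vec Term m
appAll []       ts = []
appAll (h ∷ hs) ts = app h ts ∷ appAll hs ts

mutual
  TermScoped : ℕ → Term → Set
  TermScoped k (var i)    = i < k
  TermScoped k `0         = ⊤
  TermScoped k (S t)      = TermScoped k t
  TermScoped k (app f ts) = TermsScoped k ts

  TermsScoped : ∀ {n} → ℕ → Vec Term n → Set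
  TermsScoped k []       = ⊤
  TermsScoped k (t ∷ ts) = TermScoped k t × TermsScoped k ts

infixr 6 _∧_
infixr 5 _∨_
infixr 4 _⇒_
infix  7 _≐_

data Formula : Set where
  _≐_  : Term → Term → Formula
  ⊥'   : Formula
  _∧_  : Formula → Formula → Formula
  _∨_  : Formula → Formula → Formula
  _⇒_  : Formula → Formula → Formula
  ∀'   : Formula → Formula
  ∃'   : Formula → Formula

¬' : Formula → Formula
¬' A = A ⇒ ⊥'

data Atomic : Formula → Set where
  atom : ∀ t u → Atomic (t ≐ u)

FormulaScoped : ℕ → Formula → Set
FormulaScoped k (t ≐ u) = TermScoped k t × TermScoped k u
FormulaScoped k ⊥'      = ⊤
FormulaScoped k (A ∧ B) = FormulaScoped k A × FormulaScoped k B
FormulaScoped k (A ∨ B) = FormulaScoped k A × FormulaScoped k B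
FormulaScoped k (A ⇒ B) = FormulaScoped k A × FormulaScoped k B
FormulaScoped k (∀' A)  = FormulaScoped (suc k) A
FormulaScoped k (∃' A)  = FormulaScoped (suc k) A

wk : Subst
wk k = var (suc k)

lift : Subst → Subst
lift σ zero    = var zero
lift σ (suc k) = sub wk (σ k)

fsub : Subst → Formula → Formula
fsub σ (t ≐ u) = sub σ t ≐ sub σ u
fsub σ ⊥'      = ⊥'
fsub σ (A ∧ B) = fsub σ A ∧ fsub σ B
fsub σ (A ∨ B) = fsub σ A ∨ fsub σ B
fsub σ (A ⇒ B) = fsub σ A ⇒ fsub σ B
fsub σ (∀' A)  = ∀' (fsub (lift σ) A)
fsub σ (∃' A)  = ∃' (fsub (lift σ) A)

single : Term → Subst
single t zero    = t
single t (suc k) = var k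

_[_] : Formula → Term → Formula
A [ t ] = fsub (single t) A

stepSub : Subst
stepSub zero    = S (var zero)
stepSub (suc k) = var (suc k)

Ctx : Set
Ctx = List Formula

↑ : Ctx → Ctx
↑ Γ = map (fsub wk) Γ

-- Atomic complement.  (t ≐ u)⊥ is the atomic formula  eqb(t,u) = 0,
-- where eqb(a,b) = 1 ∸ ((a ∸ b) + (b ∸ a)) is the primitive recursive
-- characteristic function of equality; it holds iff t ≠ u.

predPR : PR 1
predPR = Rec Z (Proj (fs f0))

-- revMonus (b , a) = a ∸ b
revMonus : PR 2
revMonus = Rec (Proj f0) (Comp predPR (Proj f0 ∷ []))

monusPR : PR 2            -- monus (a , b) = a ∸ b
monusPR = Comp revMonus (Proj (fs f0) ∷ Proj f0 ∷ [])

addPR : PR 2              -- add (b , a) = b + a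
addPR = Rec (Proj f0) (Comp Succ (Proj f0 ∷ []))

onePR : PR 2
onePR = Comp Succ (Z ∷ [])

eqbPR : PR 2
eqbPR = Comp monusPR
          (onePR ∷ Comp addPR (monusPR ∷ Comp monusPR (Proj (fs f0) ∷ Proj f0 ∷ []) ∷ []) ∷ [])

_ᶜ : ∀ {A} → Atomic A → Formula
atom t u ᶜ = app eqbPR (t ∷ u ∷ []) ≐ `0

data Sys : Set where
  HA PA HAEM1⁻ : Sys

infix 2 _⊢[_]_

data _⊢[_]_ : Ctx → Sys → Formula → Set where
  hyp  : ∀ {Γ s A} → A ∈ Γ → Γ ⊢[ s ] A
  ⊥E   : ∀ {Γ s A} → Γ ⊢[ s ] ⊥' → Γ ⊢[ s ] A
  ∧I   : ∀ {Γ s A B} → Γ ⊢[ s ] A → Γ ⊢[ s ] B → Γ ⊢[ s ] A ∧ B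
  ∧E₁  : ∀ {Γ s A B} → Γ ⊢[ s ] A ∧ B → Γ ⊢[ s ] A
  ∧E₂  : ∀ {Γ s A B} → Γ ⊢[ s ] A ∧ B → Γ ⊢[ s ] B
  ∨I₁  : ∀ {Γ s A B} → Γ ⊢[ s ] A → Γ ⊢[ s ] A ∨ B
  ∨I₂  : ∀ {Γ s A B} → Γ ⊢[ s ] B → Γ ⊢[ s ] A ∨ B
  ∨E   : ∀ {Γ s A B C} → Γ ⊢[ s ] A ∨ B → (A ∷ Γ) ⊢[ s ] C → (B ∷ Γ) ⊢[ s ] C
         → Γ ⊢[ s ] C
  ⇒I   : ∀ {Γ s A B} → (A ∷ Γ) ⊢[ s ] B → Γ ⊢[ s ] A ⇒ B
  ⇒E   : ∀ {Γ s A B} → Γ ⊢[ s ] A ⇒ B → Γ ⊢[ s ] A → Γ ⊢[ s ] B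
  ∀I   : ∀ {Γ s A} → ↑ Γ ⊢[ s ] A → Γ ⊢[ s ] ∀' A
  ∀E   : ∀ {Γ s A} (t : Term) → Γ ⊢[ s ] ∀' A → Γ ⊢[ s ] A [ t ]
  ∃I   : ∀ {Γ s A} (t : Term) → Γ ⊢[ s ] A [ t ] → Γ ⊢[ s ] ∃' A
  ∃E   : ∀ {Γ s A C} → Γ ⊢[ s ] ∃' A → (A ∷ ↑ Γ) ⊢[ s ] fsub wk C → Γ ⊢[ s ] C
  refl≐ : ∀ {Γ s} (t : Term) → Γ ⊢[ s ] t ≐ t
  subst≐ : ∀ {Γ s t u} (A : Formula) → Γ ⊢[ s ] t ≐ u → Γ ⊢[ s ] A [ t ] → Γ ⊢[ s ] A [ u ]
  S≠0  : ∀ {Γ s t} → Γ ⊢[ s ] S t ≐ `0 → Γ ⊢[ s ] ⊥'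
  Sinj : ∀ {Γ s t u} → Γ ⊢[ s ] S t ≐ S u → Γ ⊢[ s ] t ≐ u
  eqZ    : ∀ {Γ s n} (ts : Vec Term n) → Γ ⊢[ s ] app Z ts ≐ `0
  eqSucc : ∀ {Γ s} (t : Term) → Γ ⊢[ s ] app Succ (t ∷ []) ≐ S t
  eqProj : ∀ {Γ s n} (i : Fin n) (ts : Vec Term n) → Γ ⊢[ s ] app (Proj i) ts ≐ lookup ts i
  eqComp : ∀ {Γ s m n} (g : PR m) (hs : Vec (PR n) m) (ts : Vec Term n)
           → Γ ⊢[ s ] app (Comp g hs) ts ≐ app g (appAll hs ts)
  eqRec0 : ∀ {Γ s n} (g : PR n) (h : PR (suc (suc n))) (ts : Vec Term n)
           → Γ ⊢[ s ] app (Rec g h) (`0 ∷ ts) ≐ app g ts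
  eqRecS : ∀ {Γ s n} (g : PR n) (h : PR (suc (suc n))) (t : Term) (ts : Vec Term n)
           → Γ ⊢[ s ] app (Rec g h) (S t ∷ ts) ≐ app h (app (Rec g h) (t ∷ ts) ∷ t ∷ ts)
  ind  : ∀ {Γ s A} → Γ ⊢[ s ] A [ `0 ] → (A ∷ ↑ Γ) ⊢[ s ] fsub stepSub A → Γ ⊢[ s ] ∀' A
  em   : ∀ {Γ A C} → (A ∷ Γ) ⊢[ PA ] C → (¬' A ∷ Γ) ⊢[ PA ] C → Γ ⊢[ PA ] C
  em1⁻ : ∀ {Γ Q C} (q : Atomic Q) → Atomic C
         → (∀' Q ∷ Γ) ⊢[ HAEM1⁻ ] ∃' C → (∃' (q ᶜ) ∷ Γ) ⊢[ HAEM1⁻ ] ∃' C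
         → Γ ⊢[ HAEM1⁻ ] ∃' C

-- Friedman's A-translation: the Gödel–Gentzen negative translation with ⊥ read
-- as the closed formula R := ∃x P.  It maps PA-derivations to HA-derivations,
-- because every translated formula A is R-stable (((A ⇒ R) ⇒ R) ⇒ A), which is
-- all excluded middle needs.  The translation of ∃x P is ∀x((P ⇒ R) ⇒ R) ⇒ R,
-- and P ⇒ R is just ∃-introduction, so we obtain ∃x P itself in HA.
module Submission where

open import Defs
open import Data.List using ([]; _∷_; map)
open import Data.List.Membership.Propositional.Properties using (∈-map⁺)
open import Data.List.Relation.Binary.Subset.Propositional using (_⊆_)
open import Data.List.Relation.Binary.Subset.Propositional.Properties using (map⁺; ∷⁺ʳ)
open import Data.List.Relation.Unary.Any using (here; there)
open import Data.Nat using (zero; suc; _<_; s≤s)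
open import Data.Product using (_,_)
open import Data.Vec using (Vec; []; _∷_)
open import Relation.Binary.PropositionalEquality using (_≡_; refl; sym; trans; cong; cong₂)

mutual
  sub-∘ : ∀ σ τ t → sub σ (sub τ t) ≡ sub (λ i → sub σ (τ i)) t
  sub-∘ σ τ (var k)    = refl
  sub-∘ σ τ `0         = refl
  sub-∘ σ τ (S t)      = cong S (sub-∘ σ τ t)
  sub-∘ σ τ (app f ts) = cong (app f) (subs-∘ σ τ ts)

  subs-∘ : ∀ {n} σ τ (ts : Vec Term n) → subs σ (subs τ ts) ≡ subs (λ i → sub σ (τ i)) ts
  subs-∘ σ τ []       = refl
  subs-∘ σ τ (t ∷ ts) = cong₂ _∷_ (sub-∘ σ τ t) (subs-∘ σ τ ts)

mutual
  sub-cong : ∀ {σ τ} → (∀ i → σ i ≡ τ i) → ∀ t → sub σ t ≡ sub τ t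
  sub-cong e (var k)    = e k
  sub-cong e `0         = refl
  sub-cong e (S t)      = cong S (sub-cong e t)
  sub-cong e (app f ts) = cong (app f) (subs-cong e ts)

  subs-cong : ∀ {n σ τ} → (∀ i → σ i ≡ τ i) → (ts : Vec Term n) → subs σ ts ≡ subs τ ts
  subs-cong e []       = refl
  subs-cong e (t ∷ ts) = cong₂ _∷_ (sub-cong e t) (subs-cong e ts)

mutual
  sub-id : ∀ {σ} → (∀ i → σ i ≡ var i) → ∀ t → sub σ t ≡ t
  sub-id e (var i)    = e i
  sub-id e `0         = refl
  sub-id e (S t)      = cong S (sub-id e t)
  sub-id e (app f ts) = cong (app f) (subs-id e ts)

  subs-id : ∀ {n σ} → (∀ i → σ i ≡ var i) → (ts : Vec Term n) → subs σ ts ≡ ts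
  subs-id e []       = refl
  subs-id e (t ∷ ts) = cong₂ _∷_ (sub-id e t) (subs-id e ts)

mutual
  sub-id-scoped : ∀ {σ} k → (∀ i → i < k → σ i ≡ var i) → ∀ t → TermScoped k t → sub σ t ≡ t
  sub-id-scoped k e (var i)    p = e i p
  sub-id-scoped k e `0         p = refl
  sub-id-scoped k e (S t)      p = cong S (sub-id-scoped k e t p)
  sub-id-scoped k e (app f ts) p = cong (app f) (subs-id-scoped k e ts p)

  subs-id-scoped : ∀ {n σ} k → (∀ i → i < k → σ i ≡ var i)
                 → (ts : Vec Term n) → TermsScoped k ts → subs σ ts ≡ ts
  subs-id-scoped k e []       p       = refl
  subs-id-scoped k e (t ∷ ts) (p , q) = cong₂ _∷_ (sub-id-scoped k e t p) (subs-id-scoped k e ts q)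

lift-∘ : ∀ σ τ ρ → (∀ i → sub σ (τ i) ≡ ρ i) → ∀ i → sub (lift σ) (lift τ i) ≡ lift ρ i
lift-∘ σ τ ρ e zero    = refl
lift-∘ σ τ ρ e (suc i) =
  trans (sub-∘ (lift σ) wk (τ i)) (trans (sym (sub-∘ wk σ (τ i))) (cong (sub wk) (e i)))

fsub-∘ : ∀ σ τ ρ → (∀ i → sub σ (τ i) ≡ ρ i) → ∀ A → fsub σ (fsub τ A) ≡ fsub ρ A
fsub-∘ σ τ ρ e (t ≐ u) =
  cong₂ _≐_ (trans (sub-∘ σ τ t) (sub-cong e t)) (trans (sub-∘ σ τ u) (sub-cong e u))
fsub-∘ σ τ ρ e ⊥'      = refl
fsub-∘ σ τ ρ e (A ∧ B) = cong₂ _∧_ (fsub-∘ σ τ ρ e A) (fsub-∘ σ τ ρ e B)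
fsub-∘ σ τ ρ e (A ∨ B) = cong₂ _∨_ (fsub-∘ σ τ ρ e A) (fsub-∘ σ τ ρ e B)
fsub-∘ σ τ ρ e (A ⇒ B) = cong₂ _⇒_ (fsub-∘ σ τ ρ e A) (fsub-∘ σ τ ρ e B)
fsub-∘ σ τ ρ e (∀' A)  = cong ∀' (fsub-∘ (lift σ) (lift τ) (lift ρ) (lift-∘ σ τ ρ e) A)
fsub-∘ σ τ ρ e (∃' A)  = cong ∃' (fsub-∘ (lift σ) (lift τ) (lift ρ) (lift-∘ σ τ ρ e) A)

lift-id : ∀ {σ} → (∀ i → σ i ≡ var i) → ∀ i → lift σ i ≡ var i
lift-id e zero    = refl
lift-id e (suc i) = cong (sub wk) (e i)

fsub-id : ∀ {σ} → (∀ i → σ i ≡ var i) → ∀ A → fsub σ A ≡ A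
fsub-id e (t ≐ u) = cong₂ _≐_ (sub-id e t) (sub-id e u)
fsub-id e ⊥'      = refl
fsub-id e (A ∧ B) = cong₂ _∧_ (fsub-id e A) (fsub-id e B)
fsub-id e (A ∨ B) = cong₂ _∨_ (fsub-id e A) (fsub-id e B)
fsub-id e (A ⇒ B) = cong₂ _⇒_ (fsub-id e A) (fsub-id e B)
fsub-id e (∀' A)  = cong ∀' (fsub-id (lift-id e) A)
fsub-id e (∃' A)  = cong ∃' (fsub-id (lift-id e) A)

lift-id-scoped : ∀ {σ} k → (∀ i → i < k → σ i ≡ var i) → ∀ i → i < suc k → lift σ i ≡ var i
lift-id-scoped k e zero    p       = refl
lift-id-scoped k e (suc i) (s≤s p) = cong (sub wk) (e i p)

fsub-id-scoped : ∀ {σ} k → (∀ i → i < k → σ i ≡ var i) → ∀ A → FormulaScoped k A → fsub σ A ≡ A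
fsub-id-scoped k e (t ≐ u) (p , q) = cong₂ _≐_ (sub-id-scoped k e t p) (sub-id-scoped k e u q)
fsub-id-scoped k e ⊥'      p       = refl
fsub-id-scoped k e (A ∧ B) (p , q) = cong₂ _∧_ (fsub-id-scoped k e A p) (fsub-id-scoped k e B q)
fsub-id-scoped k e (A ∨ B) (p , q) = cong₂ _∨_ (fsub-id-scoped k e A p) (fsub-id-scoped k e B q)
fsub-id-scoped k e (A ⇒ B) (p , q) = cong₂ _⇒_ (fsub-id-scoped k e A p) (fsub-id-scoped k e B q)
fsub-id-scoped k e (∀' A)  p       = cong ∀' (fsub-id-scoped (suc k) (lift-id-scoped k e) A p)
fsub-id-scoped k e (∃' A)  p       = cong ∃' (fsub-id-scoped (suc k) (lift-id-scoped k e) A p)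

fsub-closed : ∀ {A} → FormulaScoped 0 A → ∀ σ → fsub σ A ≡ A
fsub-closed {A} sc σ = fsub-id-scoped 0 (λ _ ()) A sc

single-var0-scoped1 : ∀ {A} → FormulaScoped 1 A → A [ var zero ] ≡ A
single-var0-scoped1 {A} = fsub-id-scoped 1 (λ { zero _ → refl ; (suc i) (s≤s ()) }) A

single-var0-lift-wk : ∀ A → fsub (lift wk) A [ var zero ] ≡ A
single-var0-lift-wk A = trans (fsub-∘ (single (var zero)) (lift wk) var e A) (fsub-id (λ _ → refl) A)
  where
  e : ∀ i → sub (single (var zero)) (lift wk i) ≡ var i
  e zero    = refl
  e (suc i) = refl

↑-mono : ∀ {Γ Δ} → Γ ⊆ Δ → ↑ Γ ⊆ ↑ Δ
↑-mono = map⁺ (fsub wk)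

weaken : ∀ {Γ Δ s A} → Γ ⊆ Δ → Γ ⊢[ s ] A → Δ ⊢[ s ] A
weaken ρ (hyp x)            = hyp (ρ x)
weaken ρ (⊥E d)             = ⊥E (weaken ρ d)
weaken ρ (∧I d e)           = ∧I (weaken ρ d) (weaken ρ e)
weaken ρ (∧E₁ d)            = ∧E₁ (weaken ρ d)
weaken ρ (∧E₂ d)            = ∧E₂ (weaken ρ d)
weaken ρ (∨I₁ d)            = ∨I₁ (weaken ρ d)
weaken ρ (∨I₂ d)            = ∨I₂ (weaken ρ d)
weaken ρ (∨E d e f)         = ∨E (weaken ρ d) (weaken (∷⁺ʳ _ ρ) e) (weaken (∷⁺ʳ _ ρ) f)
weaken ρ (⇒I d)             = ⇒I (weaken (∷⁺ʳ _ ρ) d)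
weaken ρ (⇒E d e)           = ⇒E (weaken ρ d) (weaken ρ e)
weaken ρ (∀I d)             = ∀I (weaken (↑-mono ρ) d)
weaken ρ (∀E t d)           = ∀E t (weaken ρ d)
weaken ρ (∃I t d)           = ∃I t (weaken ρ d)
weaken ρ (∃E d e)           = ∃E (weaken ρ d) (weaken (∷⁺ʳ _ (↑-mono ρ)) e)
weaken ρ (refl≐ t)          = refl≐ t
weaken ρ (subst≐ A d e)     = subst≐ A (weaken ρ d) (weaken ρ e)
weaken ρ (S≠0 d)            = S≠0 (weaken ρ d)
weaken ρ (Sinj d)           = Sinj (weaken ρ d)
weaken ρ (eqZ ts)           = eqZ ts
weaken ρ (eqSucc t)         = eqSucc t
weaken ρ (eqProj i ts)      = eqProj i ts
weaken ρ (eqComp g hs ts)   = eqComp g hs ts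
weaken ρ (eqRec0 g h ts)    = eqRec0 g h ts
weaken ρ (eqRecS g h t ts)  = eqRecS g h t ts
weaken ρ (ind d e)          = ind (weaken ρ d) (weaken (∷⁺ʳ _ (↑-mono ρ)) e)
weaken ρ (em d e)           = em (weaken (∷⁺ʳ _ ρ) d) (weaken (∷⁺ʳ _ ρ) e)
weaken ρ (em1⁻ q c d e)     = em1⁻ q c (weaken (∷⁺ʳ _ ρ) d) (weaken (∷⁺ʳ _ ρ) e)

weaken₁ : ∀ {Γ s A B} → Γ ⊢[ s ] A → (B ∷ Γ) ⊢[ s ] A
weaken₁ = weaken there

weaken-under₁ : ∀ {Γ s A B C} → (A ∷ Γ) ⊢[ s ] C → (A ∷ B ∷ Γ) ⊢[ s ] C
weaken-under₁ = weaken (∷⁺ʳ _ there)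

cast : ∀ {Γ s A B} → A ≡ B → Γ ⊢[ s ] A → Γ ⊢[ s ] B
cast refl d = d

cast-ctx : ∀ {Γ Δ s A} → Γ ≡ Δ → Γ ⊢[ s ] A → Δ ⊢[ s ] A
cast-ctx refl d = d

hyp₀ : ∀ {Γ s A} → (A ∷ Γ) ⊢[ s ] A
hyp₀ = hyp (here refl)

hyp₁ : ∀ {Γ s A B} → (B ∷ A ∷ Γ) ⊢[ s ] A
hyp₁ = hyp (there (here refl))

hyp₂ : ∀ {Γ s A B C} → (C ∷ B ∷ A ∷ Γ) ⊢[ s ] A
hyp₂ = hyp (there (there (here refl)))

module FriedmanTranslation (R : Formula) (R-closed : ∀ σ → fsub σ R ≡ R) where

  infix 8 _ᴿ

  _ᴿ : Formula → Formula
  (t ≐ u) ᴿ = ((t ≐ u) ⇒ R) ⇒ R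
  ⊥'      ᴿ = R
  (A ∧ B) ᴿ = A ᴿ ∧ B ᴿ
  (A ∨ B) ᴿ = ((A ᴿ ⇒ R) ∧ (B ᴿ ⇒ R)) ⇒ R
  (A ⇒ B) ᴿ = A ᴿ ⇒ B ᴿ
  ∀' A    ᴿ = ∀' (A ᴿ)
  ∃' A    ᴿ = ∀' (A ᴿ ⇒ R) ⇒ R

  ᴿ-fsub : ∀ σ A → fsub σ (A ᴿ) ≡ fsub σ A ᴿ
  ᴿ-fsub σ (t ≐ u) rewrite R-closed σ = refl
  ᴿ-fsub σ ⊥'      = R-closed σ
  ᴿ-fsub σ (A ∧ B) = cong₂ _∧_ (ᴿ-fsub σ A) (ᴿ-fsub σ B)
  ᴿ-fsub σ (A ∨ B) rewrite R-closed σ | ᴿ-fsub σ A | ᴿ-fsub σ B = refl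
  ᴿ-fsub σ (A ⇒ B) = cong₂ _⇒_ (ᴿ-fsub σ A) (ᴿ-fsub σ B)
  ᴿ-fsub σ (∀' A)  = cong ∀' (ᴿ-fsub (lift σ) A)
  ᴿ-fsub σ (∃' A)  rewrite R-closed σ | R-closed (lift σ) | ᴿ-fsub (lift σ) A = refl

  ᴿ-↑ : ∀ Γ → map _ᴿ (↑ Γ) ≡ ↑ (map _ᴿ Γ)
  ᴿ-↑ []      = refl
  ᴿ-↑ (A ∷ Γ) = cong₂ _∷_ (sym (ᴿ-fsub wk A)) (ᴿ-↑ Γ)

  ⇒R-stable : ∀ {Γ s} B → Γ ⊢[ s ] (((B ⇒ R) ⇒ R) ⇒ R) ⇒ (B ⇒ R)
  ⇒R-stable B = ⇒I (⇒I (⇒E hyp₁ (⇒I (⇒E hyp₀ hyp₁))))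

  ᴿ-stable : ∀ {Γ s} A → Γ ⊢[ s ] ((A ᴿ ⇒ R) ⇒ R) ⇒ A ᴿ
  ᴿ-stable (t ≐ u) = ⇒R-stable ((t ≐ u) ⇒ R)
  ᴿ-stable ⊥'      = ⇒I (⇒E hyp₀ (⇒I hyp₀))
  ᴿ-stable (A ∧ B) = ⇒I (∧I (⇒E (ᴿ-stable A) (under ∧E₁)) (⇒E (ᴿ-stable B) (under ∧E₂)))
    where
    under : ∀ {Γ s X} → (∀ {Δ} → Δ ⊢[ s ] A ᴿ ∧ B ᴿ → Δ ⊢[ s ] X)
          → ((((A ᴿ ∧ B ᴿ) ⇒ R) ⇒ R) ∷ Γ) ⊢[ s ] (X ⇒ R) ⇒ R
    under f = ⇒I (⇒E hyp₁ (⇒I (⇒E hyp₁ (f hyp₀))))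
  ᴿ-stable (A ∨ B) = ⇒R-stable ((A ᴿ ⇒ R) ∧ (B ᴿ ⇒ R))
  ᴿ-stable (A ⇒ B) =
    ⇒I (⇒I (⇒E (ᴿ-stable B) (⇒I (⇒E hyp₂ (⇒I (⇒E hyp₁ (⇒E hyp₀ hyp₂)))))))
  ᴿ-stable {Γ} (∀' A) =
    ⇒I (∀I (⇒E (ᴿ-stable A) (⇒I (⇒E (weaken₁ ¬¬∀A) (⇒I (⇒E hyp₁ instantiate))))))
    where
    ¬¬∀A : (fsub wk ((∀' (A ᴿ) ⇒ R) ⇒ R) ∷ ↑ Γ) ⊢[ _ ] (∀' (fsub (lift wk) (A ᴿ)) ⇒ R) ⇒ R
    ¬¬∀A = cast (cong (λ X → (∀' (fsub (lift wk) (A ᴿ)) ⇒ X) ⇒ X) (R-closed wk)) hyp₀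
    instantiate : ∀ {Δ s} → (∀' (fsub (lift wk) (A ᴿ)) ∷ Δ) ⊢[ s ] A ᴿ
    instantiate = cast (single-var0-lift-wk (A ᴿ)) (∀E (var zero) hyp₀)
  ᴿ-stable (∃' A)  = ⇒R-stable (∀' (A ᴿ ⇒ R))

  ᴿ-raa : ∀ {Γ s} C → ((C ᴿ ⇒ R) ∷ Γ) ⊢[ s ] R → Γ ⊢[ s ] C ᴿ
  ᴿ-raa C d = ⇒E (ᴿ-stable C) (⇒I d)

  atomᴿ-intro : ∀ {Γ s a} → ((a ⇒ R) ∷ Γ) ⊢[ s ] a → Γ ⊢[ s ] (a ⇒ R) ⇒ R
  atomᴿ-intro d = ⇒I (⇒E hyp₀ d)

  ᴿ-↑-ctx : ∀ {Γ s A B} → (A ∷ map _ᴿ (↑ Γ)) ⊢[ s ] B → (A ∷ ↑ (map _ᴿ Γ)) ⊢[ s ] B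
  ᴿ-↑-ctx {Γ} = cast-ctx (cong (_ ∷_) (ᴿ-↑ Γ))

  translate : ∀ {Γ s A} → Γ ⊢[ PA ] A → map _ᴿ Γ ⊢[ s ] A ᴿ
  translate (hyp x)           = hyp (∈-map⁺ _ᴿ x)
  translate {A = C} (⊥E d)    = ᴿ-raa C (weaken₁ (translate d))
  translate (∧I d e)          = ∧I (translate d) (translate e)
  translate (∧E₁ d)           = ∧E₁ (translate d)
  translate (∧E₂ d)           = ∧E₂ (translate d)
  translate (∨I₁ d)           = ⇒I (⇒E (∧E₁ hyp₀) (weaken₁ (translate d)))
  translate (∨I₂ d)           = ⇒I (⇒E (∧E₂ hyp₀) (weaken₁ (translate d)))
  translate {A = C} (∨E d e f) = ᴿ-raa C (⇒E (weaken₁ (translate d))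
    (∧I (⇒I (⇒E hyp₁ (weaken-under₁ (translate e))))
        (⇒I (⇒E hyp₁ (weaken-under₁ (translate f))))))
  translate (⇒I d)            = ⇒I (translate d)
  translate (⇒E d e)          = ⇒E (translate d) (translate e)
  translate {Γ} (∀I d)        = ∀I (cast-ctx (ᴿ-↑ Γ) (translate d))
  translate (∀E {A = A} t d)  = cast (ᴿ-fsub (single t) A) (∀E t (translate d))
  translate (∃I {A = A} t d)  =
    ⇒I (⇒E (cast (cong (fsub (single t) (A ᴿ) ⇒_) (R-closed (single t))) (∀E t hyp₀))
           (weaken₁ (cast (sym (ᴿ-fsub (single t) A)) (translate d))))
  translate {Γ} {s} {C} (∃E {A = A} d e) =
    ᴿ-raa C (⇒E (weaken₁ (translate d)) (∀I (⇒I (⇒E ¬Cᴿ↑ (weaken-under₁ Cᴿ↑)))))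
    where
    Cᴿ↑ : (A ᴿ ∷ ↑ (map _ᴿ Γ)) ⊢[ s ] fsub wk (C ᴿ)
    Cᴿ↑ = ᴿ-↑-ctx (cast (sym (ᴿ-fsub wk C)) (translate e))
    ¬Cᴿ↑ : (A ᴿ ∷ ↑ ((C ᴿ ⇒ R) ∷ map _ᴿ Γ)) ⊢[ s ] fsub wk (C ᴿ) ⇒ R
    ¬Cᴿ↑ = cast (cong (fsub wk (C ᴿ) ⇒_) (R-closed wk)) hyp₁
  translate (refl≐ t)         = atomᴿ-intro (refl≐ t)
  translate {Γ} {s} (subst≐ {t = t} {u = u} A d e) =
    ᴿ-raa (A [ u ]) (⇒E (weaken₁ (translate d)) (⇒I (⇒E hyp₁ (cast (ᴿ-fsub (single u) A) Aᴿ[u]))))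
    where
    Aᴿ[t] : map _ᴿ Γ ⊢[ s ] fsub (single t) (A ᴿ)
    Aᴿ[t] = cast (sym (ᴿ-fsub (single t) A)) (translate e)
    Aᴿ[u] : ((t ≐ u) ∷ ((A [ u ]) ᴿ ⇒ R) ∷ map _ᴿ Γ) ⊢[ s ] fsub (single u) (A ᴿ)
    Aᴿ[u] = subst≐ (A ᴿ) hyp₀ (weaken₁ (weaken₁ Aᴿ[t]))
  translate (S≠0 d)           = ⇒E (translate d) (⇒I (⊥E (S≠0 hyp₀)))
  translate (Sinj d)          = ⇒I (⇒E (weaken₁ (translate d)) (⇒I (⇒E hyp₁ (Sinj hyp₀))))
  translate (eqZ ts)          = atomᴿ-intro (eqZ ts)
  translate (eqSucc t)        = atomᴿ-intro (eqSucc t)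
  translate (eqProj i ts)     = atomᴿ-intro (eqProj i ts)
  translate (eqComp g hs ts)  = atomᴿ-intro (eqComp g hs ts)
  translate (eqRec0 g h ts)   = atomᴿ-intro (eqRec0 g h ts)
  translate (eqRecS g h t ts) = atomᴿ-intro (eqRecS g h t ts)
  translate (ind {A = A} d e) =
    ind (cast (sym (ᴿ-fsub (single `0) A)) (translate d))
        (ᴿ-↑-ctx (cast (sym (ᴿ-fsub stepSub A)) (translate e)))
  translate {A = C} (em d e)  =
    ᴿ-raa C (⇒E hyp₀ (⇒E (⇒I (weaken-under₁ (translate e))) (⇒I (⇒E hyp₁ (weaken-under₁ (translate d))))))

PA-∃atomic-conservative : ∀ {P} s → Atomic P → FormulaScoped 1 P → [] ⊢[ PA ] ∃' P → [] ⊢[ s ] ∃' P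
PA-∃atomic-conservative {P} s (atom _ _) sc d =
  ⇒E (translate d) (∀I (⇒I (⇒E hyp₀ (⇒I (∃I (var zero) (cast (sym (single-var0-scoped1 sc)) hyp₀))))))
  where
  open FriedmanTranslation (∃' P) (fsub-closed sc)

mainTheorem12 : (P : Formula) → Atomic P → FormulaScoped 1 P
    → [] ⊢[ PA ] ∃' P → [] ⊢[ HAEM1⁻ ] ∃' P
mainTheorem12 P = PA-∃atomic-conservative HAEM1⁻
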